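{- Let $n,k\in\mathbb{N}$ and let $\bm d:A_n\cup B_n\to\mathbb{N}$ satisfy $\|\bm d-\bm h_0(n)\|_1=2k$ and $\sum_{i}\bm d(a_i)=\sum_i\bm d(b_i)$. Then $G\mapsto\vec\nabla(G)$ is a bijection between $\mathcal{G}(\bm d)$ and the set of integer $k$-flows in $F_n$ (subdigraphs $D$ of $F_n$) in which each $a_i$ is a source of $(\bm d(a_i)-\bm h_0(n)(a_i))^-$ and a sink of $(\bm d(a_i)-\bm h_0(n)(a_i))^+$ units and each $b_i$ is a source of $(\bm d(b_i)-\bm h_0(n)(b_i))^+$ and a sink of $(\bm d(b_i)-\bm h_0(n)(b_i))^-$ units, i.e.\ $\varrho_D(a_i)-\delta_D(a_i)=\bm d(a_i)-\bm h_0(n)(a_i)$ and $\delta_D(b_i)-\varrho_D(b_i)=\bm d(b_i)-\bm h_0(n)(b_i)$ for all $i$.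
   Context: $A_n=\{a_1,\dots,a_n\}$, $B_n=\{b_1,\dots,b_n\}$; $\bm h_0(n)(a_i)=n+1-i$, $\bm h_0(n)(b_i)=i$. $\mathcal{G}(\bm d)$ is the set of bipartite graphs with colour classes $A_n,B_n$ whose degree sequence is $\bm d$. $H_0(n)$ is the bipartite graph with $a_ib_j\in E$ iff $i\le j$ (its degree sequence is $\bm h_0(n)$). $F_n$ is the digraph on $A_n\cup B_n$ with arcs $a_i\to b_j$ iff $i\le j$ and $b_j\to a_i$ iff $j<i$, each of capacity $1$. $\vec\nabla(G)$ is the digraph with arc set obtained by orienting each edge of $E(G)\triangle E(H_0(n))$ as in $F_n$. An integer $k$-flow is a $0/1$ flow in $F_n$ in which the total amount injected at the sources is $k$. $\varrho_D,\delta_D$ denote in- and out-degree; $x^+=\max(x,0)$, $x^-=\max(-x,0)$. -}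

module Defs where

open import Data.Nat using (ℕ; zero; suc; _+_; _*_; _∸_; _≤ᵇ_; _<ᵇ_; ∣_-_∣)
open import Data.Fin using (Fin; toℕ; zero; suc)
open import Data.Bool using (Bool; true; false; if_then_else_; _xor_; _∧_)
open import Data.Sum using (_⊎_; inj₁; inj₂)
open import Data.Product using (Σ; _×_; _,_)
open import Data.Integer as ℤ using (ℤ; +_)
open import Relation.Binary.PropositionalEquality using (_≡_)

sumFin : ∀ {n} → (Fin n → ℕ) → ℕ
sumFin {zero}  f = 0
sumFin {suc n} f = f zero + sumFin (λ i → f (suc i))

-- Vertex set A_n ∪ B_n : inj₁ i = a_(i+1), inj₂ j = b_(j+1)  (Fin is 0-indexed).
Vertex : ℕ → Set
Vertex n = Fin n ⊎ Fin n

a : ∀ {n} → Fin n → Vertex n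
a = inj₁

b : ∀ {n} → Fin n → Vertex n
b = inj₂

sumV : ∀ {n} → (Vertex n → ℕ) → ℕ
sumV f = sumFin (λ i → f (a i)) + sumFin (λ j → f (b j))

count : ∀ {n} → (Vertex n → Bool) → ℕ
count P = sumV (λ v → if P v then 1 else 0)

-- h_0(n)(a_i) = n+1-i, h_0(n)(b_i) = i  (1-indexed), i.e. with i 0-indexed:
h0 : (n : ℕ) → Vertex n → ℕ
h0 n (inj₁ i) = n ∸ toℕ i
h0 n (inj₂ j) = suc (toℕ j)

-- Bipartite graph with colour classes A_n, B_n: G i j = true iff a_i b_j is an edge.
BipGraph : ℕ → Set
BipGraph n = Fin n → Fin n → Bool

adj : ∀ {n} → BipGraph n → Vertex n → Vertex n → Bool
adj G (inj₁ i) (inj₂ j) = G i j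
adj G (inj₂ j) (inj₁ i) = G i j
adj G (inj₁ _) (inj₁ _) = false
adj G (inj₂ _) (inj₂ _) = false

deg : ∀ {n} → BipGraph n → Vertex n → ℕ
deg G v = count (adj G v)

InClass : ∀ {n} → (Vertex n → ℕ) → BipGraph n → Set
InClass d G = ∀ v → deg G v ≡ d v

H0 : (n : ℕ) → BipGraph n
H0 n i j = toℕ i ≤ᵇ toℕ j

-- F_n has exactly one arc between a_i and b_j
-- (a_i → b_j if i ≤ j, b_j → a_i if j < i), all other pairs non-adjacent,
-- so a subdigraph (arc subset) is given by which of these arcs it keeps.
SubF : ℕ → Set
SubF n = Fin n → Fin n → Bool

arc : ∀ {n} → SubF n → Vertex n → Vertex n → Bool
arc D (inj₁ i) (inj₂ j) = D i j ∧ (toℕ i ≤ᵇ toℕ j)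
arc D (inj₂ j) (inj₁ i) = D i j ∧ (toℕ j <ᵇ toℕ i)
arc D (inj₁ _) (inj₁ _) = false
arc D (inj₂ _) (inj₂ _) = false

F : (n : ℕ) → SubF n
F n i j = true

outdeg : ∀ {n} → SubF n → Vertex n → ℕ
outdeg D v = count (λ w → arc D v w)

indeg : ∀ {n} → SubF n → Vertex n → ℕ
indeg D v = count (λ w → arc D w v)

nabla : ∀ {n} → BipGraph n → SubF n
nabla {n} G i j = G i j xor H0 n i j

-- Total amount injected at the sources of the 0/1 flow D:
-- Σ_v (δ_D(v) - ϱ_D(v))^+.
injected : ∀ {n} → SubF n → ℕ
injected D = sumV (λ v → outdeg D v ∸ indeg D v)

IsDFlow : (n k : ℕ) → (Vertex n → ℕ) → SubF n → Set
IsDFlow n k d D =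
  injected D ≡ k
  × (∀ i → (+ indeg D (a i)) ℤ.- (+ outdeg D (a i)) ≡ (+ d (a i)) ℤ.- (+ h0 n (a i)))
  × (∀ i → (+ outdeg D (b i)) ℤ.- (+ indeg D (b i)) ≡ (+ d (b i)) ℤ.- (+ h0 n (b i)))

dist1 : (n : ℕ) → (Vertex n → ℕ) → ℕ
dist1 n d = sumV (λ v → ∣ d v - h0 n v ∣)

-- The arc of F_n between a_i and b_j carries flow in ∇(G) exactly when the
-- pair is an edge of precisely one of G and H_0(n). Checking the four cases of
-- this pair gives, at every vertex, "in + h_0 = out + deg_G" on the A-side and
-- "out + h_0 = in + deg_G" on the B-side; so the degree constraints of 𝒢(d) are
-- exactly the source/sink constraints of the flow, and G ↦ ∇(G) is inverted by
-- D ↦ D △ H_0(n). The amount injected is then forced: summing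
-- |out − in| = |d − h_0| over all vertices gives 2k, and since every arc has
-- one tail and one head, the positive and negative parts of out − in have the
-- same total, so each is k.
module Submission where

open import Defs
open import Data.Nat using (ℕ; zero; suc; _+_; _*_; _∸_; _≤ᵇ_; _<ᵇ_; ∣_-_∣)
open import Data.Nat.Properties
  using (+-identityʳ; +-comm; +-suc; +-cancelˡ-≡; +-cancelʳ-≡; *-cancelˡ-≡; ∣-∣-comm; ∣m+n-m+o∣≡∣n-o∣)
import Data.Nat.Tactic.RingSolver as ℕ-Solver
open import Data.Fin using (Fin; toℕ; zero; suc)
open import Data.Product using (Σ; _×_; _,_)
open import Data.Bool using (Bool; true; false; if_then_else_; _xor_; _∧_; not)
open import Data.Bool.Properties using (xor-assoc; xor-same; xor-identityʳ)
open import Data.Sum using (inj₁; inj₂)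
open import Data.Integer as ℤ using (ℤ)
open import Data.Integer.Properties using (+-injective)
open import Data.Integer.Tactic.RingSolver using (solve-∀)
open import Relation.Binary.PropositionalEquality
  using (_≡_; refl; sym; trans; cong; cong₂; module ≡-Reasoning)

[_] : Bool → ℕ
[ x ] = if x then 1 else 0

xor-cancelʳ : ∀ x y → (x xor y) xor y ≡ x
xor-cancelʳ x y = trans (xor-assoc x y y) (trans (cong (x xor_) (xor-same y)) (xor-identityʳ x))

suc-≤ᵇ-suc : ∀ m n → (suc m ≤ᵇ suc n) ≡ (m ≤ᵇ n)
suc-≤ᵇ-suc zero    n = refl
suc-≤ᵇ-suc (suc m) n = refl

m<ᵇn≡not[n≤ᵇm] : ∀ m n → (m <ᵇ n) ≡ not (n ≤ᵇ m)
m<ᵇn≡not[n≤ᵇm] zero    zero          = refl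
m<ᵇn≡not[n≤ᵇm] (suc m) zero          = refl
m<ᵇn≡not[n≤ᵇm] zero    (suc zero)    = refl
m<ᵇn≡not[n≤ᵇm] zero    (suc (suc n)) = refl
m<ᵇn≡not[n≤ᵇm] (suc m) (suc n)       = trans (m<ᵇn≡not[n≤ᵇm] m n) (cong not (sym (suc-≤ᵇ-suc n m)))

∣m-n∣≡m∸n+n∸m : ∀ m n → ∣ m - n ∣ ≡ (m ∸ n) + (n ∸ m)
∣m-n∣≡m∸n+n∸m zero    zero    = refl
∣m-n∣≡m∸n+n∸m zero    (suc n) = refl
∣m-n∣≡m∸n+n∸m (suc m) zero    = sym (+-identityʳ _)
∣m-n∣≡m∸n+n∸m (suc m) (suc n) = ∣m-n∣≡m∸n+n∸m m n

m∸n+n≡n∸m+m : ∀ m n → (m ∸ n) + n ≡ (n ∸ m) + m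
m∸n+n≡n∸m+m zero    zero    = refl
m∸n+n≡n∸m+m zero    (suc n) = sym (+-identityʳ _)
m∸n+n≡n∸m+m (suc m) zero    = +-identityʳ _
m∸n+n≡n∸m+m (suc m) (suc n) =
  trans (+-suc (m ∸ n) n) (trans (cong suc (m∸n+n≡n∸m+m m n)) (sym (+-suc (n ∸ m) m)))

m+n≡o+p⇒∣p-n∣≡∣m-o∣ : ∀ m n o p → m + n ≡ o + p → ∣ p - n ∣ ≡ ∣ m - o ∣
m+n≡o+p⇒∣p-n∣≡∣m-o∣ m n o p eq = begin
  ∣ p - n ∣         ≡⟨ ∣m+n-m+o∣≡∣n-o∣ o p n ⟨
  ∣ o + p - o + n ∣ ≡⟨ cong (λ x → ∣ x - o + n ∣) eq ⟨
  ∣ m + n - o + n ∣ ≡⟨ cong₂ ∣_-_∣ (+-comm m n) (+-comm o n) ⟩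
  ∣ n + m - n + o ∣ ≡⟨ ∣m+n-m+o∣≡∣n-o∣ n m o ⟩
  ∣ m - o ∣         ∎
  where open ≡-Reasoning

private
  x-y≡[x+z]-[y+z] : ∀ (x y z : ℤ) → x ℤ.- y ≡ (x ℤ.+ z) ℤ.- (y ℤ.+ z)
  x-y≡[x+z]-[y+z] = solve-∀

  [y+x]-[y+z]≡x-z : ∀ (x y z : ℤ) → (y ℤ.+ x) ℤ.- (y ℤ.+ z) ≡ x ℤ.- z
  [y+x]-[y+z]≡x-z = solve-∀

  x+z≡[x-y]+[y+z] : ∀ (x y z : ℤ) → x ℤ.+ z ≡ (x ℤ.- y) ℤ.+ (y ℤ.+ z)
  x+z≡[x-y]+[y+z] = solve-∀

  [x-z]+[y+z]≡y+x : ∀ (x y z : ℤ) → (x ℤ.- z) ℤ.+ (y ℤ.+ z) ≡ y ℤ.+ x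
  [x-z]+[y+z]≡y+x = solve-∀

-- [+ m ℤ.+ + n] reduces to [+ (m + n)]; this is what transports the ℕ equations.
m+s≡q+r⇒m-q≡r-s : ∀ m q r s → m + s ≡ q + r → ℤ.+ m ℤ.- ℤ.+ q ≡ ℤ.+ r ℤ.- ℤ.+ s
m+s≡q+r⇒m-q≡r-s m q r s eq = begin
  ℤ.+ m ℤ.- ℤ.+ q                       ≡⟨ x-y≡[x+z]-[y+z] (ℤ.+ m) (ℤ.+ q) (ℤ.+ s) ⟩
  ℤ.+ (m + s) ℤ.- (ℤ.+ q ℤ.+ ℤ.+ s)     ≡⟨ cong (λ x → ℤ.+ x ℤ.- (ℤ.+ q ℤ.+ ℤ.+ s)) eq ⟩
  ℤ.+ (q + r) ℤ.- (ℤ.+ q ℤ.+ ℤ.+ s)     ≡⟨ [y+x]-[y+z]≡x-z (ℤ.+ r) (ℤ.+ q) (ℤ.+ s) ⟩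
  ℤ.+ r ℤ.- ℤ.+ s                       ∎
  where open ≡-Reasoning

m-q≡r-s⇒m+s≡q+r : ∀ m q r s → ℤ.+ m ℤ.- ℤ.+ q ≡ ℤ.+ r ℤ.- ℤ.+ s → m + s ≡ q + r
m-q≡r-s⇒m+s≡q+r m q r s eq = +-injective (begin
  ℤ.+ (m + s)                               ≡⟨ x+z≡[x-y]+[y+z] (ℤ.+ m) (ℤ.+ q) (ℤ.+ s) ⟩
  (ℤ.+ m ℤ.- ℤ.+ q) ℤ.+ (ℤ.+ q ℤ.+ ℤ.+ s)   ≡⟨ cong (ℤ._+ (ℤ.+ q ℤ.+ ℤ.+ s)) eq ⟩
  (ℤ.+ r ℤ.- ℤ.+ s) ℤ.+ (ℤ.+ q ℤ.+ ℤ.+ s)   ≡⟨ [x-z]+[y+z]≡y+x (ℤ.+ r) (ℤ.+ q) (ℤ.+ s) ⟩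
  ℤ.+ (q + r)                               ∎)
  where open ≡-Reasoning

sumFin-cong : ∀ {n} {f g : Fin n → ℕ} → (∀ i → f i ≡ g i) → sumFin f ≡ sumFin g
sumFin-cong {zero}  eq = refl
sumFin-cong {suc n} eq = cong₂ _+_ (eq zero) (sumFin-cong (λ i → eq (suc i)))

sumFin-zero : ∀ n → sumFin {n} (λ _ → 0) ≡ 0
sumFin-zero zero    = refl
sumFin-zero (suc n) = sumFin-zero n

private
  +-interchange : ∀ w x y z → (w + x) + (y + z) ≡ (w + y) + (x + z)
  +-interchange = ℕ-Solver.solve-∀

sumFin-+ : ∀ {n} (f g : Fin n → ℕ) → sumFin (λ i → f i + g i) ≡ sumFin f + sumFin g
sumFin-+ {zero}  f g = refl
sumFin-+ {suc n} f g =
  trans (cong (f zero + g zero +_) (sumFin-+ (λ i → f (suc i)) (λ i → g (suc i))))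
        (+-interchange (f zero) (g zero) _ _)

sumFin-swap : ∀ {m n} (f : Fin m → Fin n → ℕ)
  → sumFin (λ i → sumFin (f i)) ≡ sumFin (λ j → sumFin (λ i → f i j))
sumFin-swap {zero}  {n} f = sym (sumFin-zero n)
sumFin-swap {suc m}     f =
  trans (cong (sumFin (f zero) +_) (sumFin-swap (λ i → f (suc i))))
        (sym (sumFin-+ (f zero) (λ j → sumFin (λ i → f (suc i) j))))

sumV-cong : ∀ {n} {f g : Vertex n → ℕ} → (∀ v → f v ≡ g v) → sumV f ≡ sumV g
sumV-cong eq = cong₂ _+_ (sumFin-cong (λ i → eq (a i))) (sumFin-cong (λ j → eq (b j)))

sumV-+ : ∀ {n} (f g : Vertex n → ℕ) → sumV (λ v → f v + g v) ≡ sumV f + sumV g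
sumV-+ f g =
  trans (cong₂ _+_ (sumFin-+ (λ i → f (a i)) (λ i → g (a i))) (sumFin-+ (λ j → f (b j)) (λ j → g (b j))))
        (+-interchange (sumFin (λ i → f (a i))) _ _ _)

count-onB : ∀ {n} (P : Vertex n → Bool) → (∀ i → P (a i) ≡ false)
  → count P ≡ sumFin (λ j → [ P (b j) ])
count-onB {n} P offA = begin
  sumFin (λ i → [ P (a i) ]) + sumFin (λ j → [ P (b j) ])
    ≡⟨ cong (_+ sumFin (λ j → [ P (b j) ])) (sumFin-cong (λ i → cong [_] (offA i))) ⟩
  sumFin {n} (λ _ → 0) + sumFin (λ j → [ P (b j) ])
    ≡⟨ cong (_+ sumFin (λ j → [ P (b j) ])) (sumFin-zero n) ⟩
  sumFin (λ j → [ P (b j) ]) ∎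
  where open ≡-Reasoning

count-onA : ∀ {n} (P : Vertex n → Bool) → (∀ j → P (b j) ≡ false)
  → count P ≡ sumFin (λ i → [ P (a i) ])
count-onA {n} P offB = begin
  sumFin (λ i → [ P (a i) ]) + sumFin (λ j → [ P (b j) ])
    ≡⟨ cong (sumFin (λ i → [ P (a i) ]) +_) (sumFin-cong (λ j → cong [_] (offB j))) ⟩
  sumFin (λ i → [ P (a i) ]) + sumFin {n} (λ _ → 0)
    ≡⟨ cong (sumFin (λ i → [ P (a i) ]) +_) (sumFin-zero n) ⟩
  sumFin (λ i → [ P (a i) ]) + 0
    ≡⟨ +-identityʳ _ ⟩
  sumFin (λ i → [ P (a i) ]) ∎
  where open ≡-Reasoning

sumFin-[t≤ᵇj] : ∀ n t → sumFin {n} (λ j → [ t ≤ᵇ toℕ j ]) ≡ n ∸ t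
sumFin-[t≤ᵇj] zero    zero    = refl
sumFin-[t≤ᵇj] zero    (suc t) = refl
sumFin-[t≤ᵇj] (suc n) zero    = cong suc (sumFin-[t≤ᵇj] n zero)
sumFin-[t≤ᵇj] (suc n) (suc t) =
  trans (sumFin-cong {n} (λ j → cong [_] (suc-≤ᵇ-suc t (toℕ j)))) (sumFin-[t≤ᵇj] n t)

sumFin-[i≤ᵇj] : ∀ {n} (j : Fin n) → sumFin {n} (λ i → [ toℕ i ≤ᵇ toℕ j ]) ≡ suc (toℕ j)
sumFin-[i≤ᵇj] {suc n} zero    = cong suc (sumFin-zero n)
sumFin-[i≤ᵇj] {suc n} (suc j) =
  cong suc (trans (sumFin-cong {n} (λ i → cong [_] (suc-≤ᵇ-suc (toℕ i) (toℕ j)))) (sumFin-[i≤ᵇj] j))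

deg-H0 : ∀ n v → deg (H0 n) v ≡ h0 n v
deg-H0 n (inj₁ i) = trans (count-onB (adj (H0 n) (a i)) (λ _ → refl)) (sumFin-[t≤ᵇj] n (toℕ i))
deg-H0 n (inj₂ j) = trans (count-onA (adj (H0 n) (b j)) (λ _ → refl)) (sumFin-[i≤ᵇj] j)

sumFin-pointwise-+ : ∀ {n} {f g h k : Fin n → ℕ} → (∀ x → f x + g x ≡ h x + k x)
  → sumFin f + sumFin g ≡ sumFin h + sumFin k
sumFin-pointwise-+ {f = f} {g} {h} {k} eq =
  trans (sym (sumFin-+ f g)) (trans (sumFin-cong eq) (sumFin-+ h k))

xor-balance : ∀ g h → [ (g xor h) ∧ not h ] + [ h ] ≡ [ (g xor h) ∧ h ] + [ g ]
xor-balance false false = refl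
xor-balance false true  = refl
xor-balance true  false = refl
xor-balance true  true  = refl

-- a_i b_j is an edge of H_0(n) exactly when the arc of F_n between them points to b_j.
arc-balance : ∀ {n} (G : BipGraph n) (D : SubF n) i j → D i j ≡ nabla G i j
  → [ arc D (b j) (a i) ] + [ H0 n i j ] ≡ [ arc D (a i) (b j) ] + [ G i j ]
arc-balance G D i j eq rewrite m<ᵇn≡not[n≤ᵇm] (toℕ j) (toℕ i) | eq =
  xor-balance (G i j) (toℕ i ≤ᵇ toℕ j)

Balanced : (n : ℕ) → (Vertex n → ℕ) → SubF n → Set
Balanced n d D =
  (∀ i → indeg D (a i) + h0 n (a i) ≡ outdeg D (a i) + d (a i))
  × (∀ j → outdeg D (b j) + h0 n (b j) ≡ indeg D (b j) + d (b j))

nabla-balanced : ∀ {n} (G : BipGraph n) (D : SubF n) → (∀ i j → D i j ≡ nabla G i j)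
  → Balanced n (deg G) D
nabla-balanced {n} G D eq = balanced-a , balanced-b
  where
  open ≡-Reasoning

  balanced-a : ∀ i → indeg D (a i) + h0 n (a i) ≡ outdeg D (a i) + deg G (a i)
  balanced-a i = begin
    indeg D (a i) + h0 n (a i)
      ≡⟨ cong₂ _+_ (count-onB (λ w → arc D w (a i)) (λ _ → refl))
                   (trans (sym (deg-H0 n (a i))) (count-onB (adj (H0 n) (a i)) (λ _ → refl))) ⟩
    sumFin (λ j → [ arc D (b j) (a i) ]) + sumFin (λ j → [ H0 n i j ])
      ≡⟨ sumFin-pointwise-+ (λ j → arc-balance G D i j (eq i j)) ⟩
    sumFin (λ j → [ arc D (a i) (b j) ]) + sumFin (λ j → [ G i j ])
      ≡⟨ cong₂ _+_ (count-onB (arc D (a i)) (λ _ → refl)) (count-onB (adj G (a i)) (λ _ → refl)) ⟨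
    outdeg D (a i) + deg G (a i) ∎

  balanced-b : ∀ j → outdeg D (b j) + h0 n (b j) ≡ indeg D (b j) + deg G (b j)
  balanced-b j = begin
    outdeg D (b j) + h0 n (b j)
      ≡⟨ cong₂ _+_ (count-onA (arc D (b j)) (λ _ → refl))
                   (trans (sym (deg-H0 n (b j))) (count-onA (adj (H0 n) (b j)) (λ _ → refl))) ⟩
    sumFin (λ i → [ arc D (b j) (a i) ]) + sumFin (λ i → [ H0 n i j ])
      ≡⟨ sumFin-pointwise-+ (λ i → arc-balance G D i j (eq i j)) ⟩
    sumFin (λ i → [ arc D (a i) (b j) ]) + sumFin (λ i → [ G i j ])
      ≡⟨ cong₂ _+_ (count-onA (λ w → arc D w (b j)) (λ _ → refl)) (count-onA (adj G (b j)) (λ _ → refl)) ⟨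
    indeg D (b j) + deg G (b j) ∎

balanced-cong : ∀ {n} {d d′ : Vertex n → ℕ} {D : SubF n} → (∀ v → d v ≡ d′ v)
  → Balanced n d D → Balanced n d′ D
balanced-cong {D = D} eq (bal-a , bal-b) =
  (λ i → trans (bal-a i) (cong (outdeg D (a i) +_) (eq (a i)))) ,
  (λ j → trans (bal-b j) (cong (indeg D (b j) +_) (eq (b j))))

balanced-unique : ∀ {n} {d d′ : Vertex n → ℕ} {D : SubF n}
  → Balanced n d D → Balanced n d′ D → ∀ v → d v ≡ d′ v
balanced-unique {D = D} (bal-a , _) (bal-a′ , _) (inj₁ i) =
  +-cancelˡ-≡ (outdeg D (a i)) _ _ (trans (sym (bal-a i)) (bal-a′ i))
balanced-unique {D = D} (_ , bal-b) (_ , bal-b′) (inj₂ j) =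
  +-cancelˡ-≡ (indeg D (b j)) _ _ (trans (sym (bal-b j)) (bal-b′ j))

sumV-outdeg≡sumV-indeg : ∀ {n} (D : SubF n) → sumV (outdeg D) ≡ sumV (indeg D)
sumV-outdeg≡sumV-indeg {n} D = begin
  sumV (outdeg D)
    ≡⟨ cong₂ _+_ (sumFin-cong (λ i → count-onB (arc D (a i)) (λ _ → refl)))
                 (sumFin-cong (λ j → count-onA (arc D (b j)) (λ _ → refl))) ⟩
  sumFin (λ i → sumFin (forward i)) + sumFin (λ j → sumFin (λ i → backward i j))
    ≡⟨ cong₂ _+_ (sumFin-swap forward) (sym (sumFin-swap backward)) ⟩
  sumFin (λ j → sumFin (λ i → forward i j)) + sumFin (λ i → sumFin (backward i))
    ≡⟨ +-comm (sumFin (λ j → sumFin (λ i → forward i j))) _ ⟩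
  sumFin (λ i → sumFin (backward i)) + sumFin (λ j → sumFin (λ i → forward i j))
    ≡⟨ cong₂ _+_ (sumFin-cong (λ i → count-onB (λ w → arc D w (a i)) (λ _ → refl)))
                 (sumFin-cong (λ j → count-onA (λ w → arc D w (b j)) (λ _ → refl))) ⟨
  sumV (indeg D) ∎
  where
  open ≡-Reasoning
  forward backward : Fin n → Fin n → ℕ
  forward  i j = [ arc D (a i) (b j) ]
  backward i j = [ arc D (b j) (a i) ]

sumV-∣-∣≡2*sumV-∸ : ∀ {n} (f g : Vertex n → ℕ) → sumV f ≡ sumV g
  → sumV (λ v → ∣ f v - g v ∣) ≡ 2 * sumV (λ v → f v ∸ g v)
sumV-∣-∣≡2*sumV-∸ f g Σf≡Σg = begin
  sumV (λ v → ∣ f v - g v ∣)   ≡⟨ sumV-cong (λ v → ∣m-n∣≡m∸n+n∸m (f v) (g v)) ⟩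
  sumV (λ v → f∸g v + g∸f v)   ≡⟨ sumV-+ f∸g g∸f ⟩
  sumV f∸g + sumV g∸f          ≡⟨ cong (sumV f∸g +_) (trans (sym Σf∸g≡Σg∸f) (sym (+-identityʳ _))) ⟩
  2 * sumV f∸g                 ∎
  where
  open ≡-Reasoning
  f∸g g∸f : _ → ℕ
  f∸g v = f v ∸ g v
  g∸f v = g v ∸ f v
  Σf∸g≡Σg∸f : sumV f∸g ≡ sumV g∸f
  Σf∸g≡Σg∸f = +-cancelʳ-≡ (sumV g) _ _ (begin
    sumV f∸g + sumV g          ≡⟨ sumV-+ f∸g g ⟨
    sumV (λ v → f∸g v + g v)   ≡⟨ sumV-cong (λ v → m∸n+n≡n∸m+m (f v) (g v)) ⟩
    sumV (λ v → g∸f v + f v)   ≡⟨ sumV-+ g∸f f ⟩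
    sumV g∸f + sumV f          ≡⟨ cong (sumV g∸f +_) Σf≡Σg ⟩
    sumV g∸f + sumV g          ∎)

balanced⇒dist1≡2*injected : ∀ {n d} {D : SubF n} → Balanced n d D → dist1 n d ≡ 2 * injected D
balanced⇒dist1≡2*injected {n} {d} {D} (bal-a , bal-b) = begin
  dist1 n d                                     ≡⟨ sumV-cong ∣d-h0∣≡∣out-in∣ ⟩
  sumV (λ v → ∣ outdeg D v - indeg D v ∣)       ≡⟨ sumV-∣-∣≡2*sumV-∸ (outdeg D) (indeg D) (sumV-outdeg≡sumV-indeg D) ⟩
  2 * injected D                                ∎
  where
  open ≡-Reasoning
  ∣d-h0∣≡∣out-in∣ : ∀ v → ∣ d v - h0 n v ∣ ≡ ∣ outdeg D v - indeg D v ∣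
  ∣d-h0∣≡∣out-in∣ (inj₁ i) =
    trans (m+n≡o+p⇒∣p-n∣≡∣m-o∣ (indeg D (a i)) (h0 n (a i)) (outdeg D (a i)) (d (a i)) (bal-a i))
          (∣-∣-comm (indeg D (a i)) (outdeg D (a i)))
  ∣d-h0∣≡∣out-in∣ (inj₂ j) =
    m+n≡o+p⇒∣p-n∣≡∣m-o∣ (outdeg D (b j)) (h0 n (b j)) (indeg D (b j)) (d (b j)) (bal-b j)

flow⇒balanced : ∀ {n k d} {D : SubF n} → IsDFlow n k d D → Balanced n d D
flow⇒balanced {n} {d = d} {D} (_ , flow-a , flow-b) =
  (λ i → m-q≡r-s⇒m+s≡q+r (indeg D (a i)) (outdeg D (a i)) (d (a i)) (h0 n (a i)) (flow-a i)) ,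
  (λ j → m-q≡r-s⇒m+s≡q+r (outdeg D (b j)) (indeg D (b j)) (d (b j)) (h0 n (b j)) (flow-b j))

balanced⇒flow : ∀ {n k d} {D : SubF n} → dist1 n d ≡ 2 * k → Balanced n d D → IsDFlow n k d D
balanced⇒flow {n} {k} {d} {D} dist1≡2k bal@(bal-a , bal-b) =
  *-cancelˡ-≡ (injected D) k 2 (trans (sym (balanced⇒dist1≡2*injected {d = d} bal)) dist1≡2k) ,
  (λ i → m+s≡q+r⇒m-q≡r-s (indeg D (a i)) (outdeg D (a i)) (d (a i)) (h0 n (a i)) (bal-a i)) ,
  (λ j → m+s≡q+r⇒m-q≡r-s (outdeg D (b j)) (indeg D (b j)) (d (b j)) (h0 n (b j)) (bal-b j))

mainTheorem7 : (n k : ℕ) (d : Vertex n → ℕ)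
  → dist1 n d ≡ 2 * k
  → sumFin (λ i → d (a i)) ≡ sumFin (λ i → d (b i))
  → ((G : BipGraph n) → InClass d G → IsDFlow n k d (nabla G))
    × ((G G′ : BipGraph n) → InClass d G → InClass d G′
        → (∀ i j → nabla G i j ≡ nabla G′ i j) → ∀ i j → G i j ≡ G′ i j)
    × ((D : SubF n) → IsDFlow n k d D
        → Σ (BipGraph n) (λ G → InClass d G × (∀ i j → nabla G i j ≡ D i j)))
mainTheorem7 n k d dist1≡2k _ = nabla-isFlow , nabla-injective , nabla-surjective
  where
  nabla-isFlow : (G : BipGraph n) → InClass d G → IsDFlow n k d (nabla G)
  nabla-isFlow G G∈𝒢 =
    balanced⇒flow {d = d} dist1≡2k (balanced-cong G∈𝒢 (nabla-balanced G (nabla G) (λ _ _ → refl)))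

  nabla-injective : (G G′ : BipGraph n) → InClass d G → InClass d G′
    → (∀ i j → nabla G i j ≡ nabla G′ i j) → ∀ i j → G i j ≡ G′ i j
  nabla-injective G G′ _ _ eq i j =
    trans (sym (xor-cancelʳ (G i j) (H0 n i j)))
          (trans (cong (_xor H0 n i j) (eq i j)) (xor-cancelʳ (G′ i j) (H0 n i j)))

  nabla-surjective : (D : SubF n) → IsDFlow n k d D
    → Σ (BipGraph n) (λ G → InClass d G × (∀ i j → nabla G i j ≡ D i j))
  nabla-surjective D isFlow = G , G∈𝒢 , ∇G≡D
    where
    G : BipGraph n
    G i j = D i j xor H0 n i j
    ∇G≡D : ∀ i j → nabla G i j ≡ D i j
    ∇G≡D i j = xor-cancelʳ (D i j) (H0 n i j)
    G∈𝒢 : InClass d G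
    G∈𝒢 = balanced-unique (nabla-balanced G D (λ i j → sym (∇G≡D i j))) (flow⇒balanced {d = d} isFlow)
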